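{- Let $n\ge 1$, $k\ge 0$, $\Delta=\{(z_1,\dots,z_n)\in\mathbb{R}^n\mid 0\le z_1\le 1,\ 0\le z_{i+1}-z_i\le 1,\ k\le z_n\le k+1\}$, $V=\mathbb{Z}^n\cap\Delta$. Call a chain $M_1<\cdots<M_{n+1}$ of points of $V$ a simplex if $M_{j+1}=M_j+e_{n+1-a_j}$ for $j=1,\dots,n$ with $a_1a_2\cdots a_n$ a permutation of $[n]$, and call $a=a_1\cdots a_n$ its permutation. Then (1) the set of permutations of simplices is exactly $\{u\in\mathfrak{S}_n\mid \mathrm{des}(u^{ -1})=k\}$; and (2) two simplices have vertex sets differing in exactly one point if and only if their permutations $u,v$ satisfy one of: (i) $v$ is obtained from $u$ by exchanging $u_i$ and $u_{i+1}$ for some $i\in[n-1]$ with $u_i-u_{i+1}\ne\pm1$; (ii) $u_1\notin\{1,n\}$ and $v=u_2\cdots u_nu_1$; (iii) $v_1\notin\{1,n\}$ and $u=v_2\cdots v_nv_1$.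
   Context: $e_c$ denotes the $c$-th standard basis vector of $\mathbb{R}^n$; the order on $V$ is componentwise. For $w\in\mathfrak{S}_n$, $\mathrm{des}(w)=\#\{i\in[n-1]\mid w(i)>w(i+1)\}$, and $u^{ -1}$ is the inverse permutation. -}

module Defs where

open import Data.Nat using (ℕ; zero; suc; _<?_)
open import Data.Integer using (ℤ; +_; _+_; _-_; _≤_)
open import Data.Fin using (Fin; zero; suc; inject₁; fromℕ; toℕ; opposite; _≟_)
open import Data.Fin.Permutation using (Permutation′; _⟨$⟩ʳ_; _⟨$⟩ˡ_; transpose)
open import Data.Vec using (Vec; lookup; tabulate; zipWith)
open import Data.List using (length; filter)
open import Data.List.Base using (allFin)
open import Data.Product using (Σ; ∃; _×_)
open import Data.Sum using (_⊎_)
open import Relation.Nullary using (¬_; does)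
open import Relation.Binary.PropositionalEquality using (_≡_)

-- Throughout, n = suc m (so n ≥ 1). Indices are 0-based:
-- coordinate c ∈ {1..n} of the paper is  Fin n  value c-1, and a permutation
-- value a ∈ [n] is the Fin n value a-1.

Point : ℕ → Set
Point n = Vec ℤ n

e : ∀ {n} → Fin n → Point n
e c = tabulate (λ i → if does (i ≟ c) then + 1 else + 0)
  where
  open import Data.Bool using (if_then_else_)

_+ᵥ_ : ∀ {n} → Point n → Point n → Point n
_+ᵥ_ = zipWith _+_

InΔ : (m k : ℕ) → Point (suc m) → Set
InΔ m k z =
    (+ 0 ≤ lookup z zero × lookup z zero ≤ + 1)
  × (∀ (i : Fin m) → + 0 ≤ lookup z (suc i) - lookup z (inject₁ i)
                    × lookup z (suc i) - lookup z (inject₁ i) ≤ + 1)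
  × (+ k ≤ lookup z (fromℕ m) × lookup z (fromℕ m) ≤ + (suc k))

-- z ∈ V = ℤ^n ∩ Δ  (points are integer vectors by construction)
InV : (m k : ℕ) → Point (suc m) → Set
InV = InΔ

-- A simplex: chain M_1,…,M_{n+1} (indexed by Fin (suc n)) of points of V with
-- M_{j+1} = M_j + e_{n+1-a_j}; its permutation is a = perm.
-- (0-based: coordinate n+1-a_j becomes  opposite (a j).)
record Simplex (m k : ℕ) : Set where
  field
    M    : Fin (suc (suc m)) → Point (suc m)
    perm : Permutation′ (suc m)
    inV  : ∀ j → InV m k (M j)
    step : ∀ (j : Fin (suc m)) →
           M (suc j) ≡ M (inject₁ j) +ᵥ e (opposite (perm ⟨$⟩ʳ j))

open Simplex public

des : ∀ {m} → (Fin (suc m) → Fin (suc m)) → ℕ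
des {m} w = length (filter (λ i → toℕ (w (suc i)) <? toℕ (w (inject₁ i))) (allFin m))

desInv : ∀ {m} → Permutation′ (suc m) → ℕ
desInv u = des (u ⟨$⟩ˡ_)

IsVertex : ∀ {m k} → Simplex m k → Point (suc m) → Set
IsVertex S p = ∃ λ j → M S j ≡ p

DifferInOnePoint : ∀ {m k} → Simplex m k → Simplex m k → Set
DifferInOnePoint S T =
  ∃ λ j → ¬ IsVertex T (M S j) × (∀ j′ → ¬ IsVertex T (M S j′) → j′ ≡ j)

AdjSwap : ∀ {m} → Permutation′ (suc m) → Permutation′ (suc m) → Set
AdjSwap {m} u v = ∃ λ (i : Fin m) →
    ¬ (toℕ (u ⟨$⟩ʳ inject₁ i) ≡ suc (toℕ (u ⟨$⟩ʳ suc i)))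
  × ¬ (toℕ (u ⟨$⟩ʳ suc i) ≡ suc (toℕ (u ⟨$⟩ʳ inject₁ i)))
  × (∀ p → v ⟨$⟩ʳ p ≡ u ⟨$⟩ʳ (transpose (inject₁ i) (suc i) ⟨$⟩ʳ p))

RotCond : ∀ {m} → Permutation′ (suc m) → Permutation′ (suc m) → Set
RotCond {m} u v =
    ¬ (toℕ (u ⟨$⟩ʳ zero) ≡ 0)
  × ¬ (toℕ (u ⟨$⟩ʳ zero) ≡ m)
  × (∀ (i : Fin m) → v ⟨$⟩ʳ inject₁ i ≡ u ⟨$⟩ʳ suc i)
  × (v ⟨$⟩ʳ fromℕ m ≡ u ⟨$⟩ʳ zero)

-- A permutation u determines a lattice chain: start at a "bottom" point and at step
-- j raise coordinate  n+1-u_j  by one.  The Δ-constraints force the bottom point: its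
-- coordinate x+1 exceeds coordinate x by one exactly when coordinate x+1 is raised after
-- coordinate x, i.e. the bottom is the prefix sum of the ascents of  u⁻¹ ∘ opposite, and
-- its last coordinate is des(u⁻¹), which must equal k.  So every simplex IS the chain of
-- its permutation (vertex-formula), and conversely every chain with des(u⁻¹) = k is a
-- simplex (chain-simplex); this gives part (1).
--
-- For part (2) everything is transferred to chains.  Vertex j of a chain has coordinate
-- sum  level + j, so a vertex common to S and T sits at indices differing by the level
-- difference.  Missing bottom (resp. top) vertex forces T's chain to be S's shifted by one
-- (resp. the reverse), which happens exactly for the rotations; a missing middle vertex
-- forces the chains to agree elsewhere, which happens exactly for exchanges of adjacent,
-- non-consecutive letters.
module Submission where

open import Defs
open import Data.Nat using (ℕ; suc)
open import Data.Fin.Permutation using (Permutation′; _≈_)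
open import Data.Product using (∃; _×_)
open import Data.Sum using (_⊎_)
open import Function.Bundles using (_⇔_)
open import Relation.Binary.PropositionalEquality using (_≡_)

open import Data.Nat as N using (zero; z≤n; s≤s; _<?_)
import Data.Nat.Properties as NP
open import Data.Integer as Z using (ℤ; +_; +≤+)
import Data.Integer.Properties as ZP
open import Data.Fin using (Fin; zero; suc; inject₁; fromℕ; toℕ; opposite; _≟_)
import Data.Fin.Properties as FP
open import Data.Fin.Induction using (<-weakInduction)
open import Data.Fin.Relation.Unary.Top using (view; ‵fromℕ; ‵inject₁)
open import Data.Fin.Permutation using (_⟨$⟩ʳ_; _⟨$⟩ˡ_; inverseˡ; inverseʳ; transpose; reverse)
import Data.Fin.Permutation.Components as PC
open import Data.Vec using (Vec; lookup; tabulate)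
import Data.Vec.Properties as VP
open import Data.List using (length; filter)
import Data.List.Base as List
open import Data.Product using (Σ; _,_; proj₁; proj₂)
open import Data.Sum using (inj₁; inj₂)
open import Data.Bool using (true; false; if_then_else_)
open import Data.Empty using (⊥; ⊥-elim)
open import Relation.Nullary using (¬_; Dec; yes; no; does)
open import Relation.Nullary.Decidable using (dec-true; dec-false)
open import Relation.Unary using (Pred; Decidable)
open import Relation.Binary.PropositionalEquality
  using (refl; sym; trans; cong; cong₂; subst; subst₂; _≢_; _≗_; module ≡-Reasoning)
open import Relation.Binary.Definitions using (tri<; tri≈; tri>)
open import Function using (_∘_; mk⇔)
import Level
open import Algebra.Properties.CommutativeMonoid.Sum NP.+-0-commutativeMonoid
  using (sum; sum-cong-≗; ∑-distrib-+; ∑-permute)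

⟦_<_⟧ : ℕ → ℕ → ℕ
⟦ a < b ⟧ = if does (a <? b) then 1 else 0

⟦<⟧-yes : ∀ {a b} → a N.< b → ⟦ a < b ⟧ ≡ 1
⟦<⟧-yes {a} {b} a<b rewrite dec-true (a <? b) a<b = refl

⟦<⟧-no : ∀ {a b} → ¬ a N.< b → ⟦ a < b ⟧ ≡ 0
⟦<⟧-no {a} {b} a≮b rewrite dec-false (a <? b) a≮b = refl

⟦<⟧≤1 : ∀ a b → ⟦ a < b ⟧ N.≤ 1
⟦<⟧≤1 a b with does (a <? b)
... | true = s≤s z≤n
... | false = z≤n

⟦<⟧-sucʳ : ∀ a b → a ≢ b → ⟦ a < suc b ⟧ ≡ ⟦ a < b ⟧
⟦<⟧-sucʳ a b a≢b with a <? b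
... | yes a<b = trans (⟦<⟧-yes (NP.m<n⇒m<1+n a<b)) (sym (⟦<⟧-yes a<b))
... | no a≮b = trans (⟦<⟧-no (λ a<1+b → a≢b (NP.≤-antisym (NP.≤-pred a<1+b) (NP.≮⇒≥ a≮b))))
                     (sym (⟦<⟧-no a≮b))

⟦<⟧-sucˡ : ∀ a b → b ≢ suc a → ⟦ suc a < b ⟧ ≡ ⟦ a < b ⟧
⟦<⟧-sucˡ a b b≢1+a with a <? b
... | yes a<b = trans (⟦<⟧-yes (NP.≤∧≢⇒< a<b (b≢1+a ∘ sym))) (sym (⟦<⟧-yes a<b))
... | no a≮b = trans (⟦<⟧-no (λ 1+a<b → a≮b (NP.<-trans (NP.n<1+n a) 1+a<b))) (sym (⟦<⟧-no a≮b))

-- The two halves of the estimate  [a<j] ≤ [a<b] + [b<j] ≤ [a<j] + 1,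
-- which make consecutive coordinates of a chain vertex differ by 0 or 1.
⟦<⟧-split-lower : ∀ a b j → ⟦ a < j ⟧ N.≤ ⟦ a < b ⟧ N.+ ⟦ b < j ⟧
⟦<⟧-split-lower a b j with a <? j
... | no a≮j rewrite ⟦<⟧-no a≮j = z≤n
... | yes a<j with a <? b
...   | yes a<b rewrite ⟦<⟧-yes a<j | ⟦<⟧-yes a<b = s≤s z≤n
...   | no a≮b rewrite ⟦<⟧-yes a<j | ⟦<⟧-no a≮b | ⟦<⟧-yes {b} {j} (NP.≤-<-trans (NP.≮⇒≥ a≮b) a<j) = s≤s z≤n

⟦<⟧-split-upper : ∀ a b j → ⟦ a < b ⟧ N.+ ⟦ b < j ⟧ N.≤ ⟦ a < j ⟧ N.+ 1
⟦<⟧-split-upper a b j with a <? b | b <? j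
... | yes a<b | yes b<j rewrite ⟦<⟧-yes a<b | ⟦<⟧-yes b<j | ⟦<⟧-yes (NP.<-trans a<b b<j) = NP.≤-refl
... | no a≮b | _ rewrite ⟦<⟧-no a≮b = NP.≤-trans (⟦<⟧≤1 b j) (NP.m≤n+m 1 ⟦ a < j ⟧)
... | yes a<b | no b≮j rewrite ⟦<⟧-yes a<b | ⟦<⟧-no b≮j = NP.m≤n+m 1 ⟦ a < j ⟧

-- Kronecker delta on Fin r; δ x c is coordinate x of the basis vector e_c.
δ : ∀ {r} → Fin r → Fin r → ℕ
δ x c = if does (x ≟ c) then 1 else 0

δ-refl : ∀ {r} (c : Fin r) → δ c c ≡ 1
δ-refl c rewrite dec-true (c ≟ c) refl = refl

δ-≢ : ∀ {r} {x c : Fin r} → x ≢ c → δ x c ≡ 0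
δ-≢ {x = x} {c} x≢c rewrite dec-false (x ≟ c) x≢c = refl

δ≡1⇒≡ : ∀ {r} {x c : Fin r} → δ x c ≡ 1 → x ≡ c
δ≡1⇒≡ {x = x} {c} δ≡1 with x ≟ c
... | yes x≡c = x≡c
δ≡1⇒≡ {x = x} {c} () | no _

δ-injective : ∀ {r} {c c′ : Fin r} → (∀ x → δ x c ≡ δ x c′) → c ≡ c′
δ-injective {c = c} same = δ≡1⇒≡ (trans (sym (same c)) (δ-refl c))

lookup-e : ∀ {r} (c x : Fin r) → lookup (e c) x ≡ + δ x c
lookup-e c x rewrite VP.lookup∘tabulate (λ i → if does (i ≟ c) then + 1 else + 0) x with does (x ≟ c)
... | true = refl
... | false = refl

vec-ext : ∀ {n} {xs ys : Vec ℤ n} → (∀ i → lookup xs i ≡ lookup ys i) → xs ≡ ys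
vec-ext {xs = xs} {ys} h =
  trans (sym (VP.tabulate∘lookup xs)) (trans (VP.tabulate-cong h) (VP.tabulate∘lookup ys))

sum-δ : ∀ {r} (c : Fin r) → sum (λ x → δ x c) ≡ 1
sum-δ {suc r} zero = cong suc (sum-zeros r)
  where
  sum-zeros : ∀ s → sum (λ (_ : Fin s) → 0) ≡ 0
  sum-zeros zero = refl
  sum-zeros (suc s) = sum-zeros s
sum-δ {suc r} (suc c) = sum-δ c

length-filter : ∀ {r} {A : Set} {P : Pred A Level.zero} (P? : Decidable P) (f : Fin r → A) →
  length (filter P? (List.tabulate f)) ≡ sum (λ i → if does (P? (f i)) then 1 else 0)
length-filter {zero} P? f = refl
length-filter {suc r} P? f with does (P? (f zero))
... | true = cong suc (length-filter P? (f ∘ suc))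
... | false = length-filter P? (f ∘ suc)

des≡sum : ∀ {m} (w : Fin (suc m) → Fin (suc m)) → des w ≡ sum (λ i → ⟦ toℕ (w (suc i)) < toℕ (w (inject₁ i)) ⟧)
des≡sum w = length-filter (λ i → toℕ (w (suc i)) <? toℕ (w (inject₁ i))) (λ i → i)

-- Prefix sums:  prefix D i = D 0 + ⋯ + D (i-1).
prefix : ∀ {r} → (Fin r → ℕ) → Fin (suc r) → ℕ
prefix D zero = 0
prefix {suc r} D (suc i) = D zero N.+ prefix (D ∘ suc) i

prefix-step : ∀ {r} (D : Fin r → ℕ) (i : Fin r) → prefix D (suc i) ≡ prefix D (inject₁ i) N.+ D i
prefix-step D zero = NP.+-comm (D zero) 0
prefix-step D (suc i) =
  trans (cong (D zero N.+_) (prefix-step (D ∘ suc) i)) (sym (NP.+-assoc (D zero) _ _))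

prefix-last : ∀ {r} (D : Fin r → ℕ) → prefix D (fromℕ r) ≡ sum D
prefix-last {zero} D = refl
prefix-last {suc r} D = cong (D zero N.+_) (prefix-last (D ∘ suc))

prefix-cong : ∀ {r} {D D′ : Fin r → ℕ} → D ≗ D′ → prefix D ≗ prefix D′
prefix-cong D≗D′ zero = refl
prefix-cong {suc r} D≗D′ (suc x) = cong₂ N._+_ (D≗D′ zero) (prefix-cong (D≗D′ ∘ suc) x)

increments-determine : ∀ {r} {A B : Set} (_⊕_ : A → B → A) (D : Fin r → B) (f g : Fin (suc r) → A) →
  f zero ≡ g zero → (∀ i → f (suc i) ≡ f (inject₁ i) ⊕ D i) → (∀ i → g (suc i) ≡ g (inject₁ i) ⊕ D i) →
  f ≗ g
increments-determine _⊕_ D f g f₀≡g₀ f-step g-step zero = f₀≡g₀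
increments-determine {suc r} _⊕_ D f g f₀≡g₀ f-step g-step (suc x) =
  increments-determine _⊕_ (D ∘ suc) (f ∘ suc) (g ∘ suc)
    (trans (f-step zero) (trans (cong (_⊕ D zero) f₀≡g₀) (sym (g-step zero))))
    (f-step ∘ suc) (g-step ∘ suc) x

module IntegerBounds where
  open import Data.Integer.Tactic.RingSolver using (solve-∀)

  +1-1-cancel : ∀ x → x Z.+ + 1 Z.- + 1 ≡ x
  +1-1-cancel = solve-∀

  sub-add-cancel : ∀ x y → (x Z.- y) Z.+ y ≡ x
  sub-add-cancel = solve-∀

  x-y≤1⇒x≤y+1 : ∀ {x y} → x Z.- y Z.≤ + 1 → x Z.≤ y Z.+ + 1
  x-y≤1⇒x≤y+1 {x} {y} p = subst₂ Z._≤_ (sub-add-cancel x y) (ZP.+-comm (+ 1) y) (ZP.+-monoˡ-≤ y p)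

  +1-cancel-≤ : ∀ {x y} → x Z.+ + 1 Z.≤ y Z.+ + 1 → x Z.≤ y
  +1-cancel-≤ {x} {y} p = subst₂ Z._≤_ (+1-1-cancel x) (+1-1-cancel y) (ZP.+-monoˡ-≤ (Z.- + 1) p)

  diff-in-[0,1] : ∀ {X Y} → Y N.≤ X → X N.≤ Y N.+ 1 → (+ 0 Z.≤ + X Z.- + Y) × (+ X Z.- + Y Z.≤ + 1)
  diff-in-[0,1] {X} {Y} Y≤X X≤Y+1 rewrite ZP.m-n≡m⊖n X Y | ZP.⊖-≥ Y≤X =
    +≤+ z≤n , +≤+ (NP.m≤n+o⇒m∸n≤o X Y X≤Y+1)

open IntegerBounds using (x-y≤1⇒x≤y+1; +1-cancel-≤; diff-in-[0,1])

opposite-injective : ∀ {r} {x y : Fin r} → opposite x ≡ opposite y → x ≡ y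
opposite-injective {x = x} {y} eq =
  trans (sym (FP.opposite-involutive x)) (trans (cong opposite eq) (FP.opposite-involutive y))

opposite-inject₁ : ∀ {r} (i : Fin r) → opposite (inject₁ i) ≡ suc (opposite i)
opposite-inject₁ {suc r} zero = refl
opposite-inject₁ {suc r} (suc i) = cong inject₁ (opposite-inject₁ i)

inject₁≢suc : ∀ {r} (i : Fin r) → inject₁ i ≢ suc i
inject₁≢suc i eq = NP.<-irrefl (trans (sym (FP.toℕ-inject₁ i)) (cong toℕ eq)) (NP.n<1+n _)

consecutive⇒opposites-adjacent : ∀ {r} (α β : Fin (suc r)) → toℕ α ≡ suc (toℕ β) →
  Σ (Fin r) λ i → inject₁ i ≡ opposite α × suc i ≡ opposite β
consecutive⇒opposites-adjacent {r} α β α≡1+β = adjacent (opposite α) (opposite β) opp-eq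
  where
  adjacent : ∀ (x y : Fin (suc r)) → toℕ y ≡ suc (toℕ x) → Σ (Fin r) λ i → inject₁ i ≡ x × suc i ≡ y
  adjacent x (suc i) y≡1+x = i , FP.toℕ-injective (trans (FP.toℕ-inject₁ i) (NP.suc-injective y≡1+x)) , refl
  1+β≤r : suc (toℕ β) N.≤ r
  1+β≤r = subst (N._≤ r) α≡1+β (NP.≤-pred (FP.toℕ<n α))
  opp-eq : toℕ (opposite β) ≡ suc (toℕ (opposite α))
  opp-eq rewrite FP.opposite-prop α | FP.opposite-prop β | α≡1+β = NP.+-∸-assoc 1 1+β≤r

module _ {r : ℕ} (π : Permutation′ r) where
  perm-injective : ∀ {x y} → π ⟨$⟩ʳ x ≡ π ⟨$⟩ʳ y → x ≡ y
  perm-injective {x} {y} eq = trans (sym (inverseˡ π)) (trans (cong (π ⟨$⟩ˡ_) eq) (inverseˡ π))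

  inverse-injective : ∀ {x y} → π ⟨$⟩ˡ x ≡ π ⟨$⟩ˡ y → x ≡ y
  inverse-injective {x} {y} eq = trans (sym (inverseʳ π)) (trans (cong (π ⟨$⟩ʳ_) eq) (inverseʳ π))

  inverse-of : ∀ {a b} → π ⟨$⟩ʳ a ≡ b → π ⟨$⟩ˡ b ≡ a
  inverse-of {a} eq = trans (cong (π ⟨$⟩ˡ_) (sym eq)) (inverseˡ π)

≈⇒inverses-agree : ∀ {r} (π ρ : Permutation′ r) → π ≈ ρ → ∀ i → π ⟨$⟩ˡ i ≡ ρ ⟨$⟩ˡ i
≈⇒inverses-agree π ρ π≈ρ i = inverse-of π (trans (π≈ρ (ρ ⟨$⟩ˡ i)) (inverseʳ ρ))

module _ {r : ℕ} (i j : Fin r) where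
  transpose-i : PC.transpose i j i ≡ j
  transpose-i rewrite dec-true (i ≟ i) refl = refl

  transpose-j : j ≢ i → PC.transpose i j j ≡ i
  transpose-j j≢i rewrite dec-false (j ≟ i) j≢i | dec-true (j ≟ j) refl = refl

  transpose-other : ∀ x → x ≢ i → x ≢ j → PC.transpose i j x ≡ x
  transpose-other x x≢i x≢j rewrite dec-false (x ≟ i) x≢i | dec-false (x ≟ j) x≢j = refl

  transpose-involutive : j ≢ i → ∀ x → PC.transpose i j (PC.transpose i j x) ≡ x
  transpose-involutive j≢i x = by-cases (x ≟ i) (x ≟ j)
    where
    τ = PC.transpose i j
    by-cases : Dec (x ≡ i) → Dec (x ≡ j) → τ (τ x) ≡ x
    by-cases (yes refl) _ = trans (cong τ transpose-i) (transpose-j j≢i)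
    by-cases (no x≢i) (yes refl) = trans (cong τ (transpose-j j≢i)) transpose-i
    by-cases (no x≢i) (no x≢j) = trans (cong τ (transpose-other x x≢i x≢j)) (transpose-other x x≢i x≢j)

top : ∀ {m} → Fin (suc (suc m))
top {m} = fromℕ (suc m)

-- Step j raises coordinate  raised u j = opposite (u j),
-- so coordinate x is raised at step  raise u x = u⁻¹ (opposite x).  The bottom vertex is
-- the prefix sum of the ascent indicators of  raise u, and vertex j of the chain is
--   chain u j x = bottom u x + [raise u x < j].
module _ {m : ℕ} where
  raised : Permutation′ (suc m) → Fin (suc m) → Fin (suc m)
  raised u j = opposite (u ⟨$⟩ʳ j)

  raise : Permutation′ (suc m) → Fin (suc m) → Fin (suc m)
  raise u x = u ⟨$⟩ˡ opposite x

  time : Permutation′ (suc m) → Fin (suc m) → ℕ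
  time u x = toℕ (raise u x)

  -- Coordinate i+1 is raised after coordinate i.
  ascent : Permutation′ (suc m) → Fin m → ℕ
  ascent u i = ⟦ time u (inject₁ i) < time u (suc i) ⟧

  bottom : Permutation′ (suc m) → Fin (suc m) → ℕ
  bottom u = prefix (ascent u)

  chain : Permutation′ (suc m) → Fin (suc (suc m)) → Fin (suc m) → ℕ
  chain u j x = bottom u x N.+ ⟦ time u x < toℕ j ⟧

  raise-raised : ∀ u j → raise u (raised u j) ≡ j
  raise-raised u j = trans (cong (u ⟨$⟩ˡ_) (FP.opposite-involutive (u ⟨$⟩ʳ j))) (inverseˡ u)

  raise≡⇒raised : ∀ u x j → raise u x ≡ j → x ≡ raised u j
  raise≡⇒raised u x j eq = trans (sym (FP.opposite-involutive x))
    (cong opposite (trans (sym (inverseʳ u)) (cong (u ⟨$⟩ʳ_) eq)))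

  time-injective : ∀ u {x y} → time u x ≡ time u y → x ≡ y
  time-injective u eq = opposite-injective (inverse-injective u (FP.toℕ-injective eq))

  ⟦time<suc⟧ : ∀ u (j : Fin (suc m)) x →
    ⟦ time u x < suc (toℕ j) ⟧ ≡ ⟦ time u x < toℕ j ⟧ N.+ δ x (raised u j)
  ⟦time<suc⟧ u j x with x ≟ raised u j
  ... | yes refl rewrite raise-raised u j =
    trans (⟦<⟧-yes (NP.n<1+n (toℕ j))) (cong (N._+ 1) (sym (⟦<⟧-no {toℕ j} (NP.<-irrefl refl))))
  ... | no x≢raised =
    trans (⟦<⟧-sucʳ _ _ (λ eq → x≢raised (raise≡⇒raised u x j (FP.toℕ-injective eq))))
          (sym (NP.+-identityʳ _))

  chain-step : ∀ u (j : Fin (suc m)) x → chain u (suc j) x ≡ chain u (inject₁ j) x N.+ δ x (raised u j)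
  chain-step u j x rewrite FP.toℕ-inject₁ j | ⟦time<suc⟧ u j x = sym (NP.+-assoc (bottom u x) _ _)

  chain-zero : ∀ u x → chain u zero x ≡ bottom u x
  chain-zero u x = trans (cong (bottom u x N.+_) (⟦<⟧-no {time u x} {0} (λ ()))) (NP.+-identityʳ _)

  chain-last : ∀ u x → chain u top x ≡ bottom u x N.+ 1
  chain-last u x rewrite FP.toℕ-fromℕ (suc m) = cong (bottom u x N.+_) (⟦<⟧-yes (FP.toℕ<n (raise u x)))

  -- The last coordinate of the bottom vertex counts the descents of u⁻¹: reading the
  -- ascents of  raise u = u⁻¹ ∘ opposite  backwards gives the descents of u⁻¹.
  bottom-last≡desInv : ∀ u → bottom u (fromℕ m) ≡ desInv u
  bottom-last≡desInv u = begin
      bottom u (fromℕ m)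
    ≡⟨ prefix-last (ascent u) ⟩
      sum (ascent u)
    ≡⟨ sum-cong-≗ (λ i → cong (λ z → ⟦ toℕ (u ⟨$⟩ˡ z) < toℕ (u ⟨$⟩ˡ inject₁ (opposite i)) ⟧) (opposite-inject₁ i)) ⟩
      sum (descent ∘ opposite)
    ≡⟨ ∑-permute descent reverse ⟨
      sum descent
    ≡⟨ des≡sum (u ⟨$⟩ˡ_) ⟨
      desInv u ∎
    where
    open ≡-Reasoning
    descent : Fin m → ℕ
    descent i = ⟦ toℕ (u ⟨$⟩ˡ suc i) < toℕ (u ⟨$⟩ˡ inject₁ i) ⟧

module _ {m k : ℕ} (S : Simplex m k) (j : Fin (suc (suc m))) where
  private
    z = M S j
    z∈Δ = inV S j

  first-≥0 : + 0 Z.≤ lookup z zero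
  first-≥0 = proj₁ (proj₁ z∈Δ)

  first-≤1 : lookup z zero Z.≤ + 1
  first-≤1 = proj₂ (proj₁ z∈Δ)

  rise-≥0 : ∀ i → + 0 Z.≤ lookup z (suc i) Z.- lookup z (inject₁ i)
  rise-≥0 i = proj₁ (proj₁ (proj₂ z∈Δ) i)

  rise-≤1 : ∀ i → lookup z (suc i) Z.- lookup z (inject₁ i) Z.≤ + 1
  rise-≤1 i = proj₂ (proj₁ (proj₂ z∈Δ) i)

  last-≥k : + k Z.≤ lookup z (fromℕ m)
  last-≥k = proj₁ (proj₂ (proj₂ z∈Δ))

  last-≤k+1 : lookup z (fromℕ m) Z.≤ + suc k
  last-≤k+1 = proj₂ (proj₂ (proj₂ z∈Δ))

-- Every simplex is the chain of its permutation: the constraints of Δ at the vertices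
-- where coordinates i and i+1 differ in "raised" status force the bottom vertex.
module _ {m k : ℕ} (S : Simplex m k) where
  private
    u = perm S
    β : Fin (suc m) → ℤ
    β x = lookup (M S zero) x

  vertex-offsets : ∀ j x → lookup (M S j) x ≡ β x Z.+ + ⟦ time u x < toℕ j ⟧
  vertex-offsets = <-weakInduction (λ j → ∀ x → lookup (M S j) x ≡ β x Z.+ + ⟦ time u x < toℕ j ⟧)
    (λ x → sym (trans (cong (λ t → β x Z.+ + t) (⟦<⟧-no {time u x} {0} (λ ()))) (ZP.+-identityʳ _)))
    raise-step
    where
    raise-step : ∀ j → (∀ x → lookup (M S (inject₁ j)) x ≡ β x Z.+ + ⟦ time u x < toℕ (inject₁ j) ⟧) →
           ∀ x → lookup (M S (suc j)) x ≡ β x Z.+ + ⟦ time u x < suc (toℕ j) ⟧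
    raise-step j ih x = begin
        lookup (M S (suc j)) x
      ≡⟨ cong (λ v → lookup v x) (step S j) ⟩
        lookup (M S (inject₁ j) +ᵥ e (raised u j)) x
      ≡⟨ VP.lookup-zipWith Z._+_ x (M S (inject₁ j)) (e (raised u j)) ⟩
        lookup (M S (inject₁ j)) x Z.+ lookup (e (raised u j)) x
      ≡⟨ cong₂ Z._+_ (ih x) (lookup-e (raised u j) x) ⟩
        β x Z.+ + ⟦ time u x < toℕ (inject₁ j) ⟧ Z.+ + δ x (raised u j)
      ≡⟨ ZP.+-assoc (β x) _ _ ⟩
        β x Z.+ + (⟦ time u x < toℕ (inject₁ j) ⟧ N.+ δ x (raised u j))
      ≡⟨ cong (λ t → β x Z.+ + (⟦ time u x < t ⟧ N.+ δ x (raised u j))) (FP.toℕ-inject₁ j) ⟩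
        β x Z.+ + (⟦ time u x < toℕ j ⟧ N.+ δ x (raised u j))
      ≡⟨ cong (λ t → β x Z.+ + t) (⟦time<suc⟧ u j x) ⟨
        β x Z.+ + ⟦ time u x < suc (toℕ j) ⟧ ∎
      where open ≡-Reasoning

  raised-before : ∀ j x → time u x N.< toℕ j → lookup (M S j) x ≡ β x Z.+ + 1
  raised-before j x lt = trans (vertex-offsets j x) (cong (λ t → β x Z.+ + t) (⟦<⟧-yes lt))

  not-yet-raised : ∀ j x → ¬ time u x N.< toℕ j → lookup (M S j) x ≡ β x Z.+ + 0
  not-yet-raised j x ≮ = trans (vertex-offsets j x) (cong (λ t → β x Z.+ + t) (⟦<⟧-no ≮))

  bottom-first : β zero ≡ + 0
  bottom-first = ZP.≤-antisym (+1-cancel-≤ top-first-≤1) (first-≥0 S zero)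
    where
    top-first-≤1 : β zero Z.+ + 1 Z.≤ + 0 Z.+ + 1
    top-first-≤1 = subst (Z._≤ + 1)
      (raised-before top zero (subst (time u zero N.<_) (sym (FP.toℕ-fromℕ (suc m))) (FP.toℕ<n (raise u zero))))
      (first-≤1 S top)

  -- If coordinate i+1 is raised after coordinate i, the vertex between the two raisings
  -- has rise  β(i+1) - (β i + 1) ≥ 0, while the bottom has rise ≤ 1.
  bottom-rise-ascent : ∀ i → time u (inject₁ i) N.< time u (suc i) → β (suc i) ≡ β (inject₁ i) Z.+ + 1
  bottom-rise-ascent i asc = ZP.≤-antisym (x-y≤1⇒x≤y+1 (rise-≤1 S zero i)) lower
    where
    j = suc (raise u (inject₁ i))
    middle-rise : + 0 Z.≤ (β (suc i) Z.+ + 0) Z.- (β (inject₁ i) Z.+ + 1)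
    middle-rise = subst (λ d → + 0 Z.≤ d)
      (cong₂ Z._-_ (not-yet-raised j (suc i) (λ lt → NP.<⇒≱ asc (NP.≤-pred lt)))
                   (raised-before j (inject₁ i) (NP.n<1+n _)))
      (rise-≥0 S j i)
    lower : β (inject₁ i) Z.+ + 1 Z.≤ β (suc i)
    lower = subst (β (inject₁ i) Z.+ + 1 Z.≤_) (ZP.+-identityʳ _) (ZP.0≤i-j⇒j≤i middle-rise)

  -- If coordinate i+1 is raised first, the vertex between the two raisings has
  -- rise  (β(i+1) + 1) - β i ≤ 1, while the bottom has rise ≥ 0.
  bottom-rise-descent : ∀ i → time u (suc i) N.< time u (inject₁ i) → β (suc i) ≡ β (inject₁ i) Z.+ + 0
  bottom-rise-descent i desc = ZP.≤-antisym upper lower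
    where
    j = suc (raise u (suc i))
    middle-rise : (β (suc i) Z.+ + 1) Z.- (β (inject₁ i) Z.+ + 0) Z.≤ + 1
    middle-rise = subst (Z._≤ + 1)
      (cong₂ Z._-_ (raised-before j (suc i) (NP.n<1+n _))
                   (not-yet-raised j (inject₁ i) (λ lt → NP.<⇒≱ desc (NP.≤-pred lt))))
      (rise-≤1 S j i)
    upper : β (suc i) Z.≤ β (inject₁ i) Z.+ + 0
    upper = +1-cancel-≤ (x-y≤1⇒x≤y+1 middle-rise)
    lower : β (inject₁ i) Z.+ + 0 Z.≤ β (suc i)
    lower = subst (Z._≤ β (suc i)) (sym (ZP.+-identityʳ _)) (ZP.0≤i-j⇒j≤i (rise-≥0 S zero i))

  bottom-rise : ∀ i → β (suc i) ≡ β (inject₁ i) Z.+ + ascent u i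
  bottom-rise i with NP.<-cmp (time u (inject₁ i)) (time u (suc i))
  ... | tri< asc _ _ = trans (bottom-rise-ascent i asc) (cong (λ t → β (inject₁ i) Z.+ + t) (sym (⟦<⟧-yes asc)))
  ... | tri≈ _ same _ = ⊥-elim (inject₁≢suc i (time-injective u same))
  ... | tri> _ _ desc = trans (bottom-rise-descent i desc)
      (cong (λ t → β (inject₁ i) Z.+ + t) (sym (⟦<⟧-no (λ asc → NP.<-asym asc desc))))

  bottom-vertex : ∀ x → β x ≡ + bottom u x
  bottom-vertex = increments-determine (λ z d → z Z.+ + d) (ascent u) β (λ x → + bottom u x)
    bottom-first bottom-rise (λ i → cong +_ (prefix-step (ascent u) i))

  vertex-formula : ∀ j x → lookup (M S j) x ≡ + chain u j x
  vertex-formula j x = trans (vertex-offsets j x) (cong (Z._+ + ⟦ time u x < toℕ j ⟧) (bottom-vertex x))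

  -- The last coordinate runs from  desInv u  (bottom) to  desInv u + 1  (top), so it equals k.
  desInv≡k : desInv u ≡ k
  desInv≡k = trans (sym (bottom-last≡desInv u)) (NP.≤-antisym upper lower)
    where
    lower : k N.≤ bottom u (fromℕ m)
    lower = ZP.drop‿+≤+ (subst (+ k Z.≤_) (bottom-vertex (fromℕ m)) (last-≥k S zero))
    top-value : lookup (M S top) (fromℕ m) ≡ + (bottom u (fromℕ m) N.+ 1)
    top-value = trans (vertex-formula top (fromℕ m)) (cong +_ (chain-last u (fromℕ m)))
    upper : bottom u (fromℕ m) N.≤ k
    upper = NP.≤-pred (subst (N._≤ suc k) (NP.+-comm _ 1)
      (ZP.drop‿+≤+ (subst (Z._≤ + suc k) top-value (last-≤k+1 S top))))

chain-rise-bounds : ∀ {m} (u : Permutation′ (suc m)) j (i : Fin m) →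
  chain u j (inject₁ i) N.≤ chain u j (suc i) × chain u j (suc i) N.≤ chain u j (inject₁ i) N.+ 1
chain-rise-bounds u j i =
  subst (chain u j (inject₁ i) N.≤_) (sym split) (NP.+-monoʳ-≤ B (⟦<⟧-split-lower a b (toℕ j))) ,
  subst₂ N._≤_ (sym split) (sym (NP.+-assoc B _ 1)) (NP.+-monoʳ-≤ B (⟦<⟧-split-upper a b (toℕ j)))
  where
  a = time u (inject₁ i)
  b = time u (suc i)
  B = bottom u (inject₁ i)
  split : chain u j (suc i) ≡ B N.+ (⟦ a < b ⟧ N.+ ⟦ b < toℕ j ⟧)
  split = trans (cong (N._+ ⟦ b < toℕ j ⟧) (prefix-step (ascent u) i)) (NP.+-assoc B _ _)

chain-simplex : ∀ {m k} (u : Permutation′ (suc m)) → desInv u ≡ k → Simplex m k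
chain-simplex {m} {k} u desInv≡k = record { M = vertex ; perm = u ; inV = vertex∈V ; step = vertex-step }
  where
  vertex : Fin (suc (suc m)) → Point (suc m)
  vertex j = tabulate (λ x → + chain u j x)

  vertex-coord : ∀ j x → lookup (vertex j) x ≡ + chain u j x
  vertex-coord j x = VP.lookup∘tabulate (λ x → + chain u j x) x

  vertex-step : ∀ j → vertex (suc j) ≡ vertex (inject₁ j) +ᵥ e (raised u j)
  vertex-step j = vec-ext λ x → begin
      lookup (vertex (suc j)) x
    ≡⟨ trans (vertex-coord (suc j) x) (cong +_ (chain-step u j x)) ⟩
      + chain u (inject₁ j) x Z.+ + δ x (raised u j)
    ≡⟨ cong₂ Z._+_ (vertex-coord (inject₁ j) x) (lookup-e (raised u j) x) ⟨
      lookup (vertex (inject₁ j)) x Z.+ lookup (e (raised u j)) x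
    ≡⟨ VP.lookup-zipWith Z._+_ x (vertex (inject₁ j)) (e (raised u j)) ⟨
      lookup (vertex (inject₁ j) +ᵥ e (raised u j)) x ∎
    where open ≡-Reasoning

  bottom-last≡k : bottom u (fromℕ m) ≡ k
  bottom-last≡k = trans (bottom-last≡desInv u) desInv≡k

  vertex∈V : ∀ j → InV m k (vertex j)
  vertex∈V j = (first-lo , first-hi) , rises , (last-lo , last-hi)
    where
    at : ∀ (P : ℤ → Set) x → P (+ chain u j x) → P (lookup (vertex j) x)
    at P x = subst P (sym (vertex-coord j x))
    first-lo = at (+ 0 Z.≤_) zero (+≤+ z≤n)
    first-hi = at (Z._≤ + 1) zero (+≤+ (⟦<⟧≤1 (time u zero) (toℕ j)))
    rises : ∀ i → (+ 0 Z.≤ lookup (vertex j) (suc i) Z.- lookup (vertex j) (inject₁ i))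
                × (lookup (vertex j) (suc i) Z.- lookup (vertex j) (inject₁ i) Z.≤ + 1)
    rises i rewrite vertex-coord j (suc i) | vertex-coord j (inject₁ i) =
      diff-in-[0,1] (proj₁ (chain-rise-bounds u j i)) (proj₂ (chain-rise-bounds u j i))
    c = ⟦ time u (fromℕ m) < toℕ j ⟧
    last-lo = at (+ k Z.≤_) (fromℕ m) (+≤+ (subst (N._≤ bottom u (fromℕ m) N.+ c) bottom-last≡k (NP.m≤m+n _ c)))
    last-hi = at (Z._≤ + suc k) (fromℕ m) (+≤+ (subst (λ b → b N.+ c N.≤ suc k) (sym bottom-last≡k)
                 (subst (k N.+ c N.≤_) (NP.+-comm k 1) (NP.+-monoʳ-≤ k (⟦<⟧≤1 (time u (fromℕ m)) (toℕ j))))))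

desInv-cong : ∀ {m} (u v : Permutation′ (suc m)) → u ≈ v → desInv u ≡ desInv v
desInv-cong u v u≈v = trans (des≡sum (u ⟨$⟩ˡ_)) (trans (sum-cong-≗ same-descents) (sym (des≡sum (v ⟨$⟩ˡ_))))
  where
  same-descents : ∀ i → ⟦ toℕ (u ⟨$⟩ˡ suc i) < toℕ (u ⟨$⟩ˡ inject₁ i) ⟧ ≡ ⟦ toℕ (v ⟨$⟩ˡ suc i) < toℕ (v ⟨$⟩ˡ inject₁ i) ⟧
  same-descents i = cong₂ (λ a b → ⟦ toℕ a < toℕ b ⟧)
    (≈⇒inverses-agree u v u≈v (suc i)) (≈⇒inverses-agree u v u≈v (inject₁ i))

simplex-permutations : ∀ {m k} (u : Permutation′ (suc m)) → (∃ λ (S : Simplex m k) → perm S ≈ u) ⇔ (desInv u ≡ k)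
simplex-permutations {m} u = mk⇔
  (λ { (S , perm≈u) → trans (sym (desInv-cong (perm S) u perm≈u)) (desInv≡k S) })
  (λ desInv≡k → chain-simplex u desInv≡k , λ i → refl)

module _ {m : ℕ} where
  level : Permutation′ (suc m) → ℕ
  level u = sum (chain u zero)

  -- Each step raises one coordinate, so the coordinates of vertex j sum to  level u + j.
  chain-sum : ∀ u j → sum (chain u j) ≡ level u N.+ toℕ j
  chain-sum u = <-weakInduction (λ j → sum (chain u j) ≡ level u N.+ toℕ j) (sym (NP.+-identityʳ _)) next
    where
    next : ∀ j → sum (chain u (inject₁ j)) ≡ level u N.+ toℕ (inject₁ j) →
           sum (chain u (suc j)) ≡ level u N.+ suc (toℕ j)
    next j ih = begin
        sum (chain u (suc j))
      ≡⟨ sum-cong-≗ (chain-step u j) ⟩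
        sum (λ x → chain u (inject₁ j) x N.+ δ x (raised u j))
      ≡⟨ ∑-distrib-+ (chain u (inject₁ j)) (λ x → δ x (raised u j)) ⟩
        sum (chain u (inject₁ j)) N.+ sum (λ x → δ x (raised u j))
      ≡⟨ cong₂ N._+_ (trans ih (cong (level u N.+_) (FP.toℕ-inject₁ j))) (sum-δ (raised u j)) ⟩
        level u N.+ toℕ j N.+ 1
      ≡⟨ trans (NP.+-assoc (level u) _ 1) (cong (level u N.+_) (NP.+-comm (toℕ j) 1)) ⟩
        level u N.+ suc (toℕ j) ∎
      where open ≡-Reasoning

  letter-from-step : ∀ (u : Permutation′ (suc m)) j c → (∀ x → chain u (suc j) x ≡ chain u (inject₁ j) x N.+ δ x (opposite c)) →
                     u ⟨$⟩ʳ j ≡ c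
  letter-from-step u j c raises = opposite-injective (δ-injective λ x →
    NP.+-cancelˡ-≡ (chain u (inject₁ j) x) _ _ (trans (sym (chain-step u j x)) (raises x)))

  -- The top vertex is the bottom vertex plus (1,…,1), so either one determines the other.
  same-top⇒same-bottom : ∀ (u v : Permutation′ (suc m)) → chain v top ≗ chain u top → chain v zero ≗ chain u zero
  same-top⇒same-bottom u v same x = trans (chain-zero v x) (trans
    (NP.+-cancelʳ-≡ 1 _ _ (trans (sym (chain-last v x)) (trans (same x) (chain-last u x))))
    (sym (chain-zero u x)))

  same-bottom⇒same-top : ∀ (u v : Permutation′ (suc m)) → chain v zero ≗ chain u zero → chain v top ≗ chain u top
  same-bottom⇒same-top u v same x = trans (chain-last v x) (trans
    (cong (N._+ 1) (trans (sym (chain-zero v x)) (trans (same x) (chain-zero u x))))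
    (sym (chain-last u x)))

-- Raising times under the rotation v = u₂⋯uₙu₁: a coordinate raised at step 0 by u is
-- raised at the last step m by v, and one raised at step w+1 by u is raised at step w by v.
RotatedTime : ℕ → ℕ → ℕ → Set
RotatedTime m tu tv = (tu ≡ 0 × tv ≡ m) ⊎ Σ ℕ (λ w → tu ≡ suc w × tv ≡ w × w N.< m)

-- Under a rotation, the ascent between two coordinates changes exactly as prescribed by
-- shifting the bottom vertex up by the coordinate raised first.
rotated-ascent : ∀ m a b a′ b′ → RotatedTime m a a′ → RotatedTime m b b′ → a ≢ b →
                 ⟦ a < b ⟧ N.+ ⟦ b < 1 ⟧ ≡ ⟦ a < 1 ⟧ N.+ ⟦ a′ < b′ ⟧
rotated-ascent m .0 .0 _ _ (inj₁ (refl , _)) (inj₁ (refl , _)) a≢b = ⊥-elim (a≢b refl)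
rotated-ascent m .0 .(suc w) .m .w (inj₁ (refl , refl)) (inj₂ (w , refl , refl , w<m)) _
  rewrite ⟦<⟧-no {m} {w} (λ m<w → NP.<-asym m<w w<m) = refl
rotated-ascent m .(suc w) .0 .w .m (inj₂ (w , refl , refl , w<m)) (inj₁ (refl , refl)) _
  rewrite ⟦<⟧-yes {w} {m} w<m = refl
rotated-ascent m .(suc w) .(suc w′) .w .w′ (inj₂ (w , refl , refl , _)) (inj₂ (w′ , refl , refl , _)) _ =
  NP.+-identityʳ ⟦ w < w′ ⟧

rotated-offset : ∀ m tu tv j → RotatedTime m tu tv → j N.≤ m → ⟦ tu < 1 ⟧ N.+ ⟦ tv < j ⟧ ≡ ⟦ tu < suc j ⟧
rotated-offset m .0 .m j (inj₁ (refl , refl)) j≤m rewrite ⟦<⟧-no {m} {j} (λ m<j → NP.<⇒≱ m<j j≤m) = refl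
rotated-offset m .(suc w) .w j (inj₂ (w , refl , refl , _)) _ = refl

Shifted : ∀ {m} → Permutation′ (suc m) → Permutation′ (suc m) → Set
Shifted u v = ∀ j → chain v (inject₁ j) ≗ chain u (suc j)

module _ {m : ℕ} (u v : Permutation′ (suc m)) where
  rotation-times : RotCond u v → ∀ x → RotatedTime m (time u x) (time v x)
  rotation-times (_ , _ , shift , wrap) x = by-time (raise u x) refl
    where
    by-time : ∀ w → raise u x ≡ w → RotatedTime m (time u x) (time v x)
    by-time zero eq = inj₁ (cong toℕ eq , trans (cong toℕ raise-v) (FP.toℕ-fromℕ m))
      where
      raise-v : raise v x ≡ fromℕ m
      raise-v = inverse-of v (trans wrap (trans (cong (u ⟨$⟩ʳ_) (sym eq)) (inverseʳ u)))
    by-time (suc w) eq = inj₂ (toℕ w , cong toℕ eq , trans (cong toℕ raise-v) (FP.toℕ-inject₁ w) , FP.toℕ<n w)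
      where
      raise-v : raise v x ≡ inject₁ w
      raise-v = inverse-of v (trans (shift w) (trans (cong (u ⟨$⟩ʳ_) (sym eq)) (inverseʳ u)))

  rotation-bottom : RotCond u v → ∀ x → bottom v x ≡ bottom u x N.+ ⟦ time u x < 1 ⟧
  rotation-bottom rot@(_ , u₀≢m , _ , _) =
    increments-determine N._+_ (ascent v) (bottom v) g first (prefix-step (ascent v)) g-step
    where
    g : Fin (suc m) → ℕ
    g x = bottom u x N.+ ⟦ time u x < 1 ⟧
    -- coordinate 0 is not raised at step 0, as that would mean u₁ = n
    first : bottom v zero ≡ g zero
    first = sym (⟦<⟧-no λ t<1 → u₀≢m (trans
      (cong toℕ (sym (trans (cong opposite (raise≡⇒raised u zero zero (FP.toℕ-injective (NP.n<1⇒n≡0 t<1))))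
                            (FP.opposite-involutive (u ⟨$⟩ʳ zero)))))
      (FP.toℕ-fromℕ m)))
    g-step : ∀ i → g (suc i) ≡ g (inject₁ i) N.+ ascent v i
    g-step i = begin
        bottom u (suc i) N.+ ⟦ b < 1 ⟧
      ≡⟨ cong (N._+ ⟦ b < 1 ⟧) (prefix-step (ascent u) i) ⟩
        bottom u (inject₁ i) N.+ ⟦ a < b ⟧ N.+ ⟦ b < 1 ⟧
      ≡⟨ NP.+-assoc (bottom u (inject₁ i)) _ _ ⟩
        bottom u (inject₁ i) N.+ (⟦ a < b ⟧ N.+ ⟦ b < 1 ⟧)
      ≡⟨ cong (bottom u (inject₁ i) N.+_) (rotated-ascent m a b _ _
           (rotation-times rot (inject₁ i)) (rotation-times rot (suc i)) (inject₁≢suc i ∘ time-injective u)) ⟩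
        bottom u (inject₁ i) N.+ (⟦ a < 1 ⟧ N.+ ascent v i)
      ≡⟨ NP.+-assoc (bottom u (inject₁ i)) _ _ ⟨
        bottom u (inject₁ i) N.+ ⟦ a < 1 ⟧ N.+ ascent v i ∎
      where
      open ≡-Reasoning
      a = time u (inject₁ i)
      b = time u (suc i)

  rotation⇒shifted : RotCond u v → Shifted u v
  rotation⇒shifted rot j x = begin
      bottom v x N.+ ⟦ time v x < toℕ (inject₁ j) ⟧
    ≡⟨ cong₂ N._+_ (rotation-bottom rot x) (cong (⟦ time v x <_⟧) (FP.toℕ-inject₁ j)) ⟩
      bottom u x N.+ ⟦ time u x < 1 ⟧ N.+ ⟦ time v x < toℕ j ⟧
    ≡⟨ NP.+-assoc (bottom u x) _ _ ⟩
      bottom u x N.+ (⟦ time u x < 1 ⟧ N.+ ⟦ time v x < toℕ j ⟧)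
    ≡⟨ cong (bottom u x N.+_) (rotated-offset m _ _ (toℕ j) (rotation-times rot x) (NP.≤-pred (FP.toℕ<n j))) ⟩
      bottom u x N.+ ⟦ time u x < suc (toℕ j) ⟧ ∎
    where open ≡-Reasoning

  -- Conversely, a shifted chain comes from the rotation; u₁ ∉ {1, n} because the bottom of v
  -- is the bottom of u raised in coordinate  opposite u₁, which must keep the first
  -- coordinate 0 and the last coordinate (= des(u⁻¹) = des(v⁻¹)) unchanged.
  shifted⇒rotation : Shifted u v → desInv u ≡ desInv v → RotCond u v
  shifted⇒rotation shifted same-des = u₀≢0 , u₀≢m , shift , wrap
    where
    c₀ = raised u zero

    bottom-v : ∀ x → bottom v x ≡ bottom u x N.+ δ x c₀
    bottom-v x = trans (sym (chain-zero v x))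
      (trans (shifted zero x) (trans (chain-step u zero x) (cong (N._+ δ x c₀) (chain-zero u x))))

    shift : ∀ (i : Fin m) → v ⟨$⟩ʳ inject₁ i ≡ u ⟨$⟩ʳ suc i
    shift i = letter-from-step v (inject₁ i) (u ⟨$⟩ʳ suc i) λ x → begin
        chain v (suc (inject₁ i)) x
      ≡⟨ shifted (suc i) x ⟩
        chain u (suc (suc i)) x
      ≡⟨ chain-step u (suc i) x ⟩
        chain u (suc (inject₁ i)) x N.+ δ x (raised u (suc i))
      ≡⟨ cong (N._+ δ x (raised u (suc i))) (shifted (inject₁ i) x) ⟨
        chain v (inject₁ (inject₁ i)) x N.+ δ x (raised u (suc i)) ∎
      where open ≡-Reasoning

    wrap : v ⟨$⟩ʳ fromℕ m ≡ u ⟨$⟩ʳ zero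
    wrap = letter-from-step v (fromℕ m) (u ⟨$⟩ʳ zero) λ x → begin
        chain v top x
      ≡⟨ chain-last v x ⟩
        bottom v x N.+ 1
      ≡⟨ cong (N._+ 1) (bottom-v x) ⟩
        bottom u x N.+ δ x c₀ N.+ 1
      ≡⟨ trans (NP.+-assoc (bottom u x) _ 1) (trans (cong (bottom u x N.+_) (NP.+-comm (δ x c₀) 1))
               (sym (NP.+-assoc (bottom u x) 1 _))) ⟩
        bottom u x N.+ 1 N.+ δ x c₀
      ≡⟨ cong (N._+ δ x c₀) (trans (sym (chain-last u x)) (sym (shifted (fromℕ m) x))) ⟩
        chain v (inject₁ (fromℕ m)) x N.+ δ x c₀ ∎
      where open ≡-Reasoning

    u₀≢0 : ¬ (toℕ (u ⟨$⟩ʳ zero) ≡ 0)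
    u₀≢0 u₀≡0 = NP.m+1+n≢m _ {0} (sym (begin
        bottom u (fromℕ m)
      ≡⟨ trans (bottom-last≡desInv u) (trans same-des (sym (bottom-last≡desInv v))) ⟩
        bottom v (fromℕ m)
      ≡⟨ bottom-v (fromℕ m) ⟩
        bottom u (fromℕ m) N.+ δ (fromℕ m) c₀
      ≡⟨ cong (bottom u (fromℕ m) N.+_) (trans (cong (δ (fromℕ m) ∘ opposite) (FP.toℕ-injective {j = zero} u₀≡0))
                                               (δ-refl (fromℕ m))) ⟩
        bottom u (fromℕ m) N.+ 1 ∎))
      where open ≡-Reasoning

    u₀≢m : ¬ (toℕ (u ⟨$⟩ʳ zero) ≡ m)
    u₀≢m u₀≡m = NP.0≢1+n (trans (bottom-v zero) (cong (δ zero) c₀≡0))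
      where
      c₀≡0 : c₀ ≡ zero
      c₀≡0 = FP.toℕ-injective (trans (FP.opposite-prop (u ⟨$⟩ʳ zero)) (trans (cong (m N.∸_) u₀≡m) (NP.n∸n≡0 m)))

opposites-adjacent⇒consecutive : ∀ {r} (i : Fin r) {α β : Fin (suc r)} →
  inject₁ i ≡ opposite α → suc i ≡ opposite β → toℕ α ≡ suc (toℕ β)
opposites-adjacent⇒consecutive i {α} {β} i≡α′ 1+i≡β′ = trans
  (cong toℕ (trans (sym (FP.opposite-involutive α)) (trans (cong opposite (sym i≡α′)) (opposite-inject₁ i))))
  (cong suc (trans (sym (FP.toℕ-inject₁ (opposite i)))
                   (cong toℕ (trans (cong opposite 1+i≡β′) (FP.opposite-involutive β)))))

-- Raising times under the exchange of the letters at steps t and t+1.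
SwappedTime : ℕ → ℕ → ℕ → Set
SwappedTime t tu tv = (tu ≡ t × tv ≡ suc t) ⊎ (tu ≡ suc t × tv ≡ t) ⊎ (tu ≢ t × tu ≢ suc t × tv ≡ tu)

swapped-offset : ∀ t tu tv j → SwappedTime t tu tv → j ≢ suc t → ⟦ tv < j ⟧ ≡ ⟦ tu < j ⟧
swapped-offset t .t .(suc t) j (inj₁ (refl , refl)) j≢1+t = ⟦<⟧-sucˡ t j j≢1+t
swapped-offset t .(suc t) .t j (inj₂ (inj₁ (refl , refl))) j≢1+t = sym (⟦<⟧-sucˡ t j j≢1+t)
swapped-offset t tu .tu j (inj₂ (inj₂ (_ , _ , refl))) _ = refl

swapped-ascent : ∀ t a b a′ b′ → SwappedTime t a a′ → SwappedTime t b b′ → a ≢ b →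
                 (a ≡ t → b ≡ suc t → ⊥) → (a ≡ suc t → b ≡ t → ⊥) → ⟦ a′ < b′ ⟧ ≡ ⟦ a < b ⟧
swapped-ascent t .t .t _ _ (inj₁ (refl , _)) (inj₁ (refl , _)) a≢b _ _ = ⊥-elim (a≢b refl)
swapped-ascent t .t .(suc t) _ _ (inj₁ (refl , _)) (inj₂ (inj₁ (refl , _))) _ up _ = ⊥-elim (up refl refl)
swapped-ascent t .t b .(suc t) .b (inj₁ (refl , refl)) (inj₂ (inj₂ (_ , b≢1+t , refl))) _ _ _ = ⟦<⟧-sucˡ t b b≢1+t
swapped-ascent t .(suc t) .t _ _ (inj₂ (inj₁ (refl , _))) (inj₁ (refl , _)) _ _ down = ⊥-elim (down refl refl)
swapped-ascent t .(suc t) .(suc t) _ _ (inj₂ (inj₁ (refl , _))) (inj₂ (inj₁ (refl , _))) a≢b _ _ = ⊥-elim (a≢b refl)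
swapped-ascent t .(suc t) b .t .b (inj₂ (inj₁ (refl , refl))) (inj₂ (inj₂ (_ , b≢1+t , refl))) _ _ _ =
  sym (⟦<⟧-sucˡ t b b≢1+t)
swapped-ascent t a .t .a .(suc t) (inj₂ (inj₂ (a≢t , _ , refl))) (inj₁ (refl , refl)) _ _ _ = ⟦<⟧-sucʳ a t a≢t
swapped-ascent t a .(suc t) .a .t (inj₂ (inj₂ (a≢t , _ , refl))) (inj₂ (inj₁ (refl , refl))) _ _ _ =
  sym (⟦<⟧-sucʳ a t a≢t)
swapped-ascent t a b .a .b (inj₂ (inj₂ (_ , _ , refl))) (inj₂ (inj₂ (_ , _ , refl))) _ _ _ = refl

Transposed : ∀ {m} → Fin m → Permutation′ (suc m) → Permutation′ (suc m) → Set
Transposed i u v = ∀ p → v ⟨$⟩ʳ p ≡ u ⟨$⟩ʳ (transpose (inject₁ i) (suc i) ⟨$⟩ʳ p)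

NonConsecutive : ∀ {m} → Fin m → Permutation′ (suc m) → Set
NonConsecutive i u = ¬ (toℕ (u ⟨$⟩ʳ inject₁ i) ≡ suc (toℕ (u ⟨$⟩ʳ suc i)))
                   × ¬ (toℕ (u ⟨$⟩ʳ suc i) ≡ suc (toℕ (u ⟨$⟩ʳ inject₁ i)))

AgreeOutside : ∀ {m} → Fin (suc (suc m)) → Permutation′ (suc m) → Permutation′ (suc m) → Set
AgreeOutside j₀ u v = ∀ j → j ≢ j₀ → chain v j ≗ chain u j

ascent-at : ∀ {m} (u : Permutation′ (suc m)) (i′ : Fin m) {a b} →
  inject₁ i′ ≡ raised u a → suc i′ ≡ raised u b → ascent u i′ ≡ ⟦ toℕ a < toℕ b ⟧
ascent-at u i′ {a} {b} at-a at-b = cong₂ (λ x y → ⟦ toℕ x < toℕ y ⟧)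
  (trans (cong (raise u) at-a) (raise-raised u a)) (trans (cong (raise u) at-b) (raise-raised u b))

module _ {m : ℕ} (u v : Permutation′ (suc m)) (i : Fin m) (transposed : Transposed i u v) where
  private
    p q : Fin (suc m)
    p = inject₁ i
    q = suc i
    τ = PC.transpose p q
    q≢p : q ≢ p
    q≢p = inject₁≢suc i ∘ sym
    toℕ-p : toℕ p ≡ toℕ i
    toℕ-p = FP.toℕ-inject₁ i

  exchanged-letters : v ⟨$⟩ʳ p ≡ u ⟨$⟩ʳ q × v ⟨$⟩ʳ q ≡ u ⟨$⟩ʳ p
  exchanged-letters = trans (transposed p) (cong (u ⟨$⟩ʳ_) (transpose-i p q)) ,
                      trans (transposed q) (cong (u ⟨$⟩ʳ_) (transpose-j p q q≢p))

  swap-times : ∀ x → SwappedTime (toℕ i) (time u x) (time v x)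
  swap-times x = by-cases (raise u x ≟ p) (raise u x ≟ q)
    where
    raise-v : raise v x ≡ τ (raise u x)
    raise-v = inverse-of v (trans (transposed (τ (raise u x)))
      (trans (cong (u ⟨$⟩ʳ_) (transpose-involutive p q q≢p (raise u x))) (inverseʳ u)))
    by-cases : Dec (raise u x ≡ p) → Dec (raise u x ≡ q) → SwappedTime (toℕ i) (time u x) (time v x)
    by-cases (yes at-p) _ = inj₁ (trans (cong toℕ at-p) toℕ-p ,
      cong toℕ (trans raise-v (trans (cong τ at-p) (transpose-i p q))))
    by-cases (no _) (yes at-q) = inj₂ (inj₁ (cong toℕ at-q ,
      trans (cong toℕ (trans raise-v (trans (cong τ at-q) (transpose-j p q q≢p)))) toℕ-p))
    by-cases (no ≢p) (no ≢q) = inj₂ (inj₂ (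
      (λ eq → ≢p (FP.toℕ-injective (trans eq (sym toℕ-p)))) ,
      (λ eq → ≢q (FP.toℕ-injective eq)) ,
      cong toℕ (trans raise-v (transpose-other p q (raise u x) ≢p ≢q))))

  ascent-flips : ∀ {a b} → v ⟨$⟩ʳ a ≡ u ⟨$⟩ʳ b → v ⟨$⟩ʳ b ≡ u ⟨$⟩ʳ a → toℕ (u ⟨$⟩ʳ a) ≡ suc (toℕ (u ⟨$⟩ʳ b)) →
    Σ (Fin m) λ i′ → ascent u i′ ≡ ⟦ toℕ a < toℕ b ⟧ × ascent v i′ ≡ ⟦ toℕ b < toℕ a ⟧
  ascent-flips {a} {b} va≡ub vb≡ua consecutive with consecutive⇒opposites-adjacent (u ⟨$⟩ʳ a) (u ⟨$⟩ʳ b) consecutive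
  ... | i′ , at-a , at-b = i′ , ascent-at u i′ at-a at-b ,
    ascent-at v i′ (trans at-a (cong opposite (sym vb≡ua))) (trans at-b (cong opposite (sym va≡ub)))

  same-ascents⇒non-consecutive : (∀ i′ → ascent v i′ ≡ ascent u i′) → NonConsecutive i u
  same-ascents⇒non-consecutive same = flip-p-q , flip-q-p
    where
    [p<q] : ⟦ toℕ p < toℕ q ⟧ ≡ 1
    [p<q] = ⟦<⟧-yes (subst (N._< suc (toℕ i)) (sym toℕ-p) (NP.n<1+n _))
    [q<p] : ⟦ toℕ q < toℕ p ⟧ ≡ 0
    [q<p] = ⟦<⟧-no (λ lt → NP.<-asym lt (subst (N._< suc (toℕ i)) (sym toℕ-p) (NP.n<1+n _)))
    flip-p-q : ¬ (toℕ (u ⟨$⟩ʳ p) ≡ suc (toℕ (u ⟨$⟩ʳ q)))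
    flip-p-q c with ascent-flips (proj₁ exchanged-letters) (proj₂ exchanged-letters) c
    ... | i′ , asc-u , asc-v = NP.0≢1+n (trans (sym (trans (sym (same i′)) (trans asc-v [q<p]))) (trans asc-u [p<q]))
    flip-q-p : ¬ (toℕ (u ⟨$⟩ʳ q) ≡ suc (toℕ (u ⟨$⟩ʳ p)))
    flip-q-p c with ascent-flips (proj₂ exchanged-letters) (proj₁ exchanged-letters) c
    ... | i′ , asc-u , asc-v = NP.0≢1+n (trans (sym (trans (same i′) (trans asc-u [q<p]))) (trans asc-v [p<q]))

  non-consecutive⇒same-ascents : NonConsecutive i u → ∀ i′ → ascent v i′ ≡ ascent u i′
  non-consecutive⇒same-ascents (flip-p-q , flip-q-p) i′ =
    swapped-ascent (toℕ i) _ _ _ _ (swap-times (inject₁ i′)) (swap-times (suc i′))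
      (inject₁≢suc i′ ∘ time-injective u) at-p-q at-q-p
    where
    at-p : ∀ x → time u x ≡ toℕ i → x ≡ raised u p
    at-p x eq = raise≡⇒raised u x p (FP.toℕ-injective (trans eq (sym toℕ-p)))
    at-q : ∀ x → time u x ≡ suc (toℕ i) → x ≡ raised u q
    at-q x eq = raise≡⇒raised u x q (FP.toℕ-injective eq)
    at-p-q : time u (inject₁ i′) ≡ toℕ i → time u (suc i′) ≡ suc (toℕ i) → ⊥
    at-p-q ea eb = flip-p-q (opposites-adjacent⇒consecutive i′ (at-p _ ea) (at-q _ eb))
    at-q-p : time u (inject₁ i′) ≡ suc (toℕ i) → time u (suc i′) ≡ toℕ i → ⊥
    at-q-p ea eb = flip-q-p (opposites-adjacent⇒consecutive i′ (at-q _ ea) (at-p _ eb))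

  swap⇒agree-outside : NonConsecutive i u → AgreeOutside (suc p) u v
  swap⇒agree-outside nc j j≢ x = cong₂ N._+_
    (prefix-cong (non-consecutive⇒same-ascents nc) x)
    (swapped-offset (toℕ i) _ _ (toℕ j) (swap-times x) (λ eq → j≢ (FP.toℕ-injective (trans eq (cong suc (sym toℕ-p))))))

  swap⇒moves-middle : NonConsecutive i u → ¬ (chain v (suc p) ≗ chain u (suc p))
  swap⇒moves-middle nc same = inject₁≢suc i (perm-injective u (trans (sym v-p≡u-p) (proj₁ exchanged-letters)))
    where
    v-p≡u-p : v ⟨$⟩ʳ p ≡ u ⟨$⟩ʳ p
    v-p≡u-p = letter-from-step v p (u ⟨$⟩ʳ p) λ x → begin
        chain v (suc p) x
      ≡⟨ same x ⟩
        chain u (suc p) x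
      ≡⟨ chain-step u p x ⟩
        chain u (inject₁ p) x N.+ δ x (raised u p)
      ≡⟨ cong (N._+ δ x (raised u p)) (swap⇒agree-outside nc (inject₁ p) (inject₁≢suc p) x) ⟨
        chain v (inject₁ p) x N.+ δ x (raised u p) ∎
      where open ≡-Reasoning

module _ {m : ℕ} (u v : Permutation′ (suc m)) (i : Fin m)
         (agree : AgreeOutside (suc (inject₁ i)) u v) (moved : ¬ (chain v (suc (inject₁ i)) ≗ chain u (suc (inject₁ i))))
         where
  private
    p q : Fin (suc m)
    p = inject₁ i
    q = suc i
    q≢p : q ≢ p
    q≢p = inject₁≢suc i ∘ sym

  same-letter-outside : ∀ r → inject₁ r ≢ suc p → suc r ≢ suc p → v ⟨$⟩ʳ r ≡ u ⟨$⟩ʳ r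
  same-letter-outside r before after = letter-from-step v r (u ⟨$⟩ʳ r) λ x →
    trans (agree (suc r) after x)
      (trans (chain-step u r x) (cong (N._+ δ x (raised u r)) (sym (agree (inject₁ r) before x))))

  same-pair-raised : ∀ x → δ x (raised u p) N.+ δ x (raised u q) ≡ δ x (raised v p) N.+ δ x (raised v q)
  same-pair-raised x = NP.+-cancelˡ-≡ (chain u (inject₁ p) x) _ _ (begin
      chain u (inject₁ p) x N.+ (δ x (raised u p) N.+ δ x (raised u q))
    ≡⟨ two-steps u ⟨
      chain u (suc q) x
    ≡⟨ agree (suc q) (λ eq → inject₁≢suc i (sym (FP.suc-injective eq))) x ⟨
      chain v (suc q) x
    ≡⟨ two-steps v ⟩
      chain v (inject₁ p) x N.+ (δ x (raised v p) N.+ δ x (raised v q))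
    ≡⟨ cong (N._+ (δ x (raised v p) N.+ δ x (raised v q))) (agree (inject₁ p) (inject₁≢suc p) x) ⟩
      chain u (inject₁ p) x N.+ (δ x (raised v p) N.+ δ x (raised v q)) ∎)
    where
    open ≡-Reasoning
    two-steps : ∀ w → chain w (suc q) x ≡ chain w (inject₁ p) x N.+ (δ x (raised w p) N.+ δ x (raised w q))
    two-steps w = trans (chain-step w q x)
      (trans (cong (N._+ δ x (raised w q)) (chain-step w p x)) (NP.+-assoc (chain w (inject₁ p) x) _ _))

  first-step-differs : raised u p ≢ raised v p
  first-step-differs eq = moved λ x → trans (chain-step v p x)
    (trans (cong₂ N._+_ (agree (inject₁ p) (inject₁≢suc p) x) (cong (δ x) (sym eq))) (sym (chain-step u p x)))

  private
    other-of-pair : ∀ {a b c d : Fin (suc m)} → (∀ x → δ x a N.+ δ x b ≡ δ x c N.+ δ x d) → a ≢ c → c ≢ d → c ≡ b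
    other-of-pair {a} {b} {c} {d} pair a≢c c≢d = δ≡1⇒≡ (begin
        δ c b
      ≡⟨ cong (N._+ δ c b) (δ-≢ (a≢c ∘ sym)) ⟨
        δ c a N.+ δ c b
      ≡⟨ pair c ⟩
        δ c c N.+ δ c d
      ≡⟨ cong₂ N._+_ (δ-refl c) (δ-≢ c≢d) ⟩
        1 ∎)
      where open ≡-Reasoning

  exchanged : v ⟨$⟩ʳ p ≡ u ⟨$⟩ʳ q × v ⟨$⟩ʳ q ≡ u ⟨$⟩ʳ p
  exchanged =
    opposite-injective (other-of-pair same-pair-raised first-step-differs
          (inject₁≢suc i ∘ perm-injective v ∘ opposite-injective)) ,
    sym (opposite-injective (other-of-pair (λ x → sym (same-pair-raised x)) (first-step-differs ∘ sym)
          (inject₁≢suc i ∘ perm-injective u ∘ opposite-injective)))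

  agree⇒transposed : Transposed i u v
  agree⇒transposed r = by-cases (r ≟ p) (r ≟ q)
    where
    by-cases : Dec (r ≡ p) → Dec (r ≡ q) → v ⟨$⟩ʳ r ≡ u ⟨$⟩ʳ PC.transpose p q r
    by-cases (yes refl) _ = trans (proj₁ exchanged) (cong (u ⟨$⟩ʳ_) (sym (transpose-i p q)))
    by-cases (no _) (yes refl) = trans (proj₂ exchanged) (cong (u ⟨$⟩ʳ_) (sym (transpose-j p q q≢p)))
    by-cases (no r≢p) (no r≢q) = trans (same-letter-outside r before after)
                                       (cong (u ⟨$⟩ʳ_) (sym (transpose-other p q r r≢p r≢q)))
      where
      before : inject₁ r ≢ suc p
      before eq = r≢q (FP.toℕ-injective (trans (sym (FP.toℕ-inject₁ r))
        (trans (cong toℕ eq) (cong suc (FP.toℕ-inject₁ i)))))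
      after : suc r ≢ suc p
      after = r≢p ∘ FP.suc-injective

  -- The bottoms agree, hence so do all ascents.
  agree⇒same-ascents : ∀ i′ → ascent v i′ ≡ ascent u i′
  agree⇒same-ascents i′ = NP.+-cancelˡ-≡ (bottom u (inject₁ i′)) _ _
    (trans (cong (N._+ ascent v i′) (sym (same-bottom (inject₁ i′))))
    (trans (sym (prefix-step (ascent v) i′)) (trans (same-bottom (suc i′)) (prefix-step (ascent u) i′))))
    where
    same-bottom : ∀ x → bottom v x ≡ bottom u x
    same-bottom x = trans (sym (chain-zero v x)) (trans (agree zero (λ ()) x) (chain-zero u x))

  agree⇒swap : AdjSwap u v
  agree⇒swap with same-ascents⇒non-consecutive u v i agree⇒transposed agree⇒same-ascents
  ... | flip-p-q , flip-q-p = i , flip-p-q , flip-q-p , agree⇒transposed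

module _ {m k : ℕ} where
  same-vertex⇒same-chain : ∀ (S T : Simplex m k) {l j} → M T l ≡ M S j → chain (perm T) l ≗ chain (perm S) j
  same-vertex⇒same-chain S T {l} {j} eq x =
    cong Z.∣_∣ (trans (sym (vertex-formula T l x)) (trans (cong (λ z → lookup z x) eq) (vertex-formula S j x)))

  same-chain⇒same-vertex : ∀ (S T : Simplex m k) {l j} → chain (perm T) l ≗ chain (perm S) j → M T l ≡ M S j
  same-chain⇒same-vertex S T {l} {j} same = vec-ext λ x →
    trans (vertex-formula T l x) (trans (cong +_ (same x)) (sym (vertex-formula S j x)))

  -- Coordinate sums: a common vertex sits at indices differing by the difference of levels.
  common-vertex-indices : ∀ (S T : Simplex m k) {l j} → M T l ≡ M S j →
    level (perm T) N.+ toℕ l ≡ level (perm S) N.+ toℕ j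
  common-vertex-indices S T {l} {j} eq =
    trans (sym (chain-sum (perm T) l)) (trans (sum-cong-≗ (same-vertex⇒same-chain S T eq)) (chain-sum (perm S) j))

  is-vertex? : ∀ (T : Simplex m k) p → Dec (IsVertex T p)
  is-vertex? T p = FP.any? (λ l → VP.≡-dec Z._≟_ (M T l) p)

  other-vertices-shared : ∀ (S T : Simplex m k) j₀ → (∀ j → ¬ IsVertex T (M S j) → j ≡ j₀) →
    ∀ j → j ≢ j₀ → IsVertex T (M S j)
  other-vertices-shared S T j₀ only j j≢j₀ with is-vertex? T (M S j)
  ... | yes on-T = on-T
  ... | no off-T = ⊥-elim (j≢j₀ (only j off-T))

  shifted⇒differ-at-bottom : ∀ (S T : Simplex m k) → Shifted (perm S) (perm T) → DifferInOnePoint S T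
  shifted⇒differ-at-bottom S T shifted = zero , bottom-missing , only-bottom
    where
    level-T : level (perm T) ≡ level (perm S) N.+ 1
    level-T = trans (sum-cong-≗ (shifted zero)) (chain-sum (perm S) (suc zero))
    bottom-missing : ¬ IsVertex T (M S zero)
    bottom-missing (l , eq) = NP.1+n≢0 (NP.+-cancelˡ-≡ (level (perm S)) _ 0
      (trans (sym (NP.+-assoc _ 1 (toℕ l))) (trans (cong (N._+ toℕ l) (sym level-T)) (common-vertex-indices S T eq))))
    only-bottom : ∀ j → ¬ IsVertex T (M S j) → j ≡ zero
    only-bottom zero _ = refl
    only-bottom (suc j) off-T = ⊥-elim (off-T (inject₁ j , same-chain⇒same-vertex S T (shifted j)))

  shifted⇒differ-at-top : ∀ (S T : Simplex m k) → Shifted (perm S) (perm T) → DifferInOnePoint T S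
  shifted⇒differ-at-top S T shifted = top , top-missing , only-top
    where
    level-T : level (perm T) ≡ level (perm S) N.+ 1
    level-T = trans (sum-cong-≗ (shifted zero)) (chain-sum (perm S) (suc zero))
    top-missing : ¬ IsVertex S (M T top)
    top-missing (l , eq) = NP.<⇒≱ (FP.toℕ<n l) (NP.≤-reflexive (NP.+-cancelˡ-≡ (level (perm S)) _ (toℕ l) (sym (begin
        level (perm S) N.+ toℕ l
      ≡⟨ common-vertex-indices T S eq ⟩
        level (perm T) N.+ toℕ (top {m})
      ≡⟨ cong₂ N._+_ level-T (FP.toℕ-fromℕ (suc m)) ⟩
        level (perm S) N.+ 1 N.+ suc m
      ≡⟨ NP.+-assoc (level (perm S)) 1 (suc m) ⟩
        level (perm S) N.+ suc (suc m) ∎))))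
      where open ≡-Reasoning
    only-top : ∀ j → ¬ IsVertex S (M T j) → j ≡ top
    only-top j off-S with view j
    ... | ‵fromℕ = refl
    ... | ‵inject₁ j′ = ⊥-elim (off-S (suc j′ , sym (same-chain⇒same-vertex S T (shifted j′))))

  swap⇒differ : ∀ (S T : Simplex m k) → AdjSwap (perm S) (perm T) → DifferInOnePoint S T
  swap⇒differ S T (i , flip-p-q , flip-q-p , transposed) = suc (inject₁ i) , middle-missing , only-middle
    where
    u = perm S
    v = perm T
    nc : NonConsecutive i u
    nc = flip-p-q , flip-q-p
    agree : AgreeOutside (suc (inject₁ i)) u v
    agree = swap⇒agree-outside u v i transposed nc
    same-level : level v ≡ level u
    same-level = sum-cong-≗ (agree zero (λ ()))
    middle-missing : ¬ IsVertex T (M S (suc (inject₁ i)))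
    middle-missing (l , eq) = swap⇒moves-middle u v i transposed nc
      (subst (λ l → chain v l ≗ chain u (suc (inject₁ i))) l≡middle (same-vertex⇒same-chain S T eq))
      where
      l≡middle : l ≡ suc (inject₁ i)
      l≡middle = FP.toℕ-injective (NP.+-cancelˡ-≡ (level u) _ _
        (trans (cong (N._+ toℕ l) (sym same-level)) (common-vertex-indices S T eq)))
    only-middle : ∀ j → ¬ IsVertex T (M S j) → j ≡ suc (inject₁ i)
    only-middle j off-T with j ≟ suc (inject₁ i)
    ... | yes j≡middle = j≡middle
    ... | no j≢middle = ⊥-elim (off-T (j , same-chain⇒same-vertex S T (agree j j≢middle)))

  located : ∀ (S T : Simplex m k) {j l′} (on-T : IsVertex T (M S j)) → toℕ (proj₁ on-T) ≡ toℕ l′ →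
    chain (perm T) l′ ≗ chain (perm S) j
  located S T {j} (l , eq) l≡l′ = subst (λ l → chain (perm T) l ≗ chain (perm S) j) (FP.toℕ-injective l≡l′)
    (same-vertex⇒same-chain S T eq)

  -- If T has all vertices of S but the bottom, T is S shifted down: its top is not the
  -- top of S (tops determine bottoms), which together with vertex 1 of S pins
  -- level T = level S + 1.
  missing-bottom⇒shifted : ∀ (S T : Simplex m k) → ¬ IsVertex T (M S zero) →
    (∀ j → j ≢ zero → IsVertex T (M S j)) → Shifted (perm S) (perm T)
  missing-bottom⇒shifted S T bottom-off shared with shared top (λ ())
  ... | lT , top-on with view lT
  ...   | ‵fromℕ = ⊥-elim (bottom-off (zero , same-chain⇒same-vertex S T
                     (same-top⇒same-bottom (perm S) (perm T) (same-vertex⇒same-chain S T top-on))))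
  ...   | ‵inject₁ l = λ j → located S T (shared (suc j) (λ ()))
                          (trans (NP.suc-injective (index-gap (shared (suc j) (λ ())))) (sym (FP.toℕ-inject₁ j)))
    where
    sS = level (perm S)
    sT = level (perm T)
    at-top : sT N.+ toℕ (inject₁ l) ≡ sS N.+ suc m
    at-top = trans (common-vertex-indices S T top-on) (cong (sS N.+_) (FP.toℕ-fromℕ (suc m)))
    upper : sT N.≤ sS N.+ 1
    upper = subst (sT N.≤_) (common-vertex-indices S T (proj₂ (shared (suc zero) (λ ())))) (NP.m≤m+n sT _)
    lower : sS N.+ 1 N.≤ sT
    lower = NP.+-cancelʳ-≤ m (sS N.+ 1) sT (subst (N._≤ sT N.+ m) (trans at-top (sym (NP.+-assoc sS 1 m)))
      (NP.+-monoʳ-≤ sT (subst (N._≤ m) (sym (FP.toℕ-inject₁ l)) (NP.≤-pred (FP.toℕ<n l)))))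
    level-T : sT ≡ sS N.+ 1
    level-T = NP.≤-antisym upper lower
    index-gap : ∀ {j} (on-T : IsVertex T (M S j)) → suc (toℕ (proj₁ on-T)) ≡ toℕ j
    index-gap (l′ , eq) = NP.+-cancelˡ-≡ sS _ _ (trans (sym (NP.+-assoc sS 1 (toℕ l′)))
      (trans (cong (N._+ toℕ l′) (sym level-T)) (common-vertex-indices S T eq)))

  -- If T has all vertices of S but the top, S is T shifted down (the mirror argument,
  -- using the bottom of S and its vertex m).
  missing-top⇒shifted : ∀ (S T : Simplex m k) → ¬ IsVertex T (M S top) →
    (∀ j → j ≢ top → IsVertex T (M S j)) → Shifted (perm T) (perm S)
  missing-top⇒shifted S T top-off shared with shared zero (λ ())
  ... | zero , bottom-on = ⊥-elim (top-off (top , same-chain⇒same-vertex S T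
          (same-bottom⇒same-top (perm S) (perm T) (same-vertex⇒same-chain S T bottom-on))))
  ... | suc l , bottom-on = λ j x → sym (located S T (shared (inject₁ j) (FP.fromℕ≢inject₁ ∘ sym))
          (trans (index-gap (shared (inject₁ j) (FP.fromℕ≢inject₁ ∘ sym))) (cong suc (FP.toℕ-inject₁ j))) x)
    where
    sS = level (perm S)
    sT = level (perm T)
    upper : sT N.+ 1 N.≤ sS
    upper = subst (sT N.+ 1 N.≤_) (trans (common-vertex-indices S T bottom-on) (NP.+-identityʳ sS))
      (NP.+-monoʳ-≤ sT (s≤s z≤n))
    lower : sS N.≤ sT N.+ 1
    lower with shared (inject₁ (fromℕ m)) (inject₁≢suc (fromℕ m))
    ... | lm , on = NP.+-cancelʳ-≤ m sS (sT N.+ 1) (subst (N._≤ sT N.+ 1 N.+ m)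
          (trans (common-vertex-indices S T on) (cong (sS N.+_) (trans (FP.toℕ-inject₁ (fromℕ m)) (FP.toℕ-fromℕ m))))
          (subst (sT N.+ toℕ lm N.≤_) (sym (NP.+-assoc sT 1 m)) (NP.+-monoʳ-≤ sT (NP.≤-pred (FP.toℕ<n lm)))))
    level-S : sS ≡ sT N.+ 1
    level-S = NP.≤-antisym lower upper
    index-gap : ∀ {j} (on-T : IsVertex T (M S j)) → toℕ (proj₁ on-T) ≡ suc (toℕ j)
    index-gap {j} (l′ , eq) = NP.+-cancelˡ-≡ sT _ _ (trans (common-vertex-indices S T eq)
      (trans (cong (N._+ toℕ j) level-S) (NP.+-assoc sT 1 (toℕ j))))

  -- If T has all vertices of S but the middle one after step i, both have the same level
  -- (compare the bottom and top of S), so their chains agree away from that vertex.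
  missing-middle⇒swap : ∀ (S T : Simplex m k) (i : Fin m) → ¬ IsVertex T (M S (suc (inject₁ i))) →
    (∀ j → j ≢ suc (inject₁ i) → IsVertex T (M S j)) → AdjSwap (perm S) (perm T)
  missing-middle⇒swap S T i middle-off shared = agree⇒swap (perm S) (perm T) i agree moved
    where
    sS = level (perm S)
    sT = level (perm T)
    upper : sT N.≤ sS
    upper with shared zero (λ ())
    ... | l0 , on = subst (sT N.≤_) (trans (common-vertex-indices S T on) (NP.+-identityʳ sS)) (NP.m≤m+n sT _)
    lower : sS N.≤ sT
    lower with shared top (FP.fromℕ≢inject₁ ∘ FP.suc-injective)
    ... | lT , on = NP.+-cancelʳ-≤ (suc m) sS sT (subst (N._≤ sT N.+ suc m)
          (trans (common-vertex-indices S T on) (cong (sS N.+_) (FP.toℕ-fromℕ (suc m))))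
          (NP.+-monoʳ-≤ sT (NP.≤-pred (FP.toℕ<n lT))))
    agree : AgreeOutside (suc (inject₁ i)) (perm S) (perm T)
    agree j j≢ with shared j j≢
    ... | l , on = located S T (l , on) (NP.+-cancelˡ-≡ sS _ _
          (trans (cong (N._+ toℕ l) (NP.≤-antisym lower upper)) (common-vertex-indices S T on)))
    moved : ¬ (chain (perm T) (suc (inject₁ i)) ≗ chain (perm S) (suc (inject₁ i)))
    moved same = middle-off (suc (inject₁ i) , same-chain⇒same-vertex S T same)

  differ⇒related : ∀ (S T : Simplex m k) → DifferInOnePoint S T →
    AdjSwap (perm S) (perm T) ⊎ RotCond (perm S) (perm T) ⊎ RotCond (perm T) (perm S)
  differ⇒related S T (j₀ , off , only) = by-missing j₀ off (other-vertices-shared S T j₀ only)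
    where
    same-des : desInv (perm S) ≡ desInv (perm T)
    same-des = trans (desInv≡k S) (sym (desInv≡k T))
    by-missing : ∀ j₀ → ¬ IsVertex T (M S j₀) → (∀ j → j ≢ j₀ → IsVertex T (M S j)) →
      AdjSwap (perm S) (perm T) ⊎ RotCond (perm S) (perm T) ⊎ RotCond (perm T) (perm S)
    by-missing zero off shared =
      inj₂ (inj₁ (shifted⇒rotation (perm S) (perm T) (missing-bottom⇒shifted S T off shared) same-des))
    by-missing (suc p) off shared with view p
    ... | ‵fromℕ = inj₂ (inj₂ (shifted⇒rotation (perm T) (perm S) (missing-top⇒shifted S T off shared) (sym same-des)))
    ... | ‵inject₁ i = inj₁ (missing-middle⇒swap S T i off shared)

  related⇒differ : ∀ (S T : Simplex m k) →
    AdjSwap (perm S) (perm T) ⊎ RotCond (perm S) (perm T) ⊎ RotCond (perm T) (perm S) → DifferInOnePoint S T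
  related⇒differ S T (inj₁ swap) = swap⇒differ S T swap
  related⇒differ S T (inj₂ (inj₁ rot)) = shifted⇒differ-at-bottom S T (rotation⇒shifted (perm S) (perm T) rot)
  related⇒differ S T (inj₂ (inj₂ rot)) = shifted⇒differ-at-top T S (rotation⇒shifted (perm T) (perm S) rot)

proposition5p2 : (m k : ℕ) →
    ((u : Permutation′ (suc m)) → (∃ λ (S : Simplex m k) → perm S ≈ u) ⇔ (desInv u ≡ k))
    × ((S T : Simplex m k) →
        DifferInOnePoint S T ⇔ (AdjSwap (perm S) (perm T) ⊎ RotCond (perm S) (perm T) ⊎ RotCond (perm T) (perm S)))
proposition5p2 m k = simplex-permutations , λ S T → mk⇔ (differ⇒related S T) (related⇒differ S T)
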